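{- For every $k\ge1$, the Wu characteristic $\omega_k$ is a ring homomorphism from the strong ring to the integers: $\omega_k(G+H)=\omega_k(G)+\omega_k(H)$, $\omega_k(G\times H)=\omega_k(G)\,\omega_k(H)$ and $\omega_k(1)=1$ for all elements $G,H$ of the strong ring.
   Context: A finite abstract simplicial complex is a finite set of nonempty finite sets closed under taking nonempty subsets; its elements are simplices with $\dim(x)=|x|-1$. The Cartesian product $A_1\times\cdots\times A_m$ of complexes is the set of cells $(x_1,\dots,x_m)$, $x_i\in A_i$, of dimension $\sum_i\dim(x_i)$ (it is in general not a simplicial complex); two cells $(x_1,\dots,x_m),(y_1,\dots,y_m)$ intersect iff $x_i\cap y_i\neq\emptyset$ for all $i$. The strong ring consists of formal finite integer combinations (signed disjoint unions) of such products of complexes; addition is disjoint union (cells in different summands never intersect), with formal negatives, multiplication is the Cartesian product extended bilinearly, $0$ is the empty complex and $1$ is the one-point complex $K_1=\{\{1\}\}$. For a cell $c$ put $\omega(c)=(-1)^{\dim c}$. For a product of complexes $G$, $\omega_k(G)=\sum\omega(c_1)\cdots\omega(c_k)$ over all ordered $k$-tuples $(c_1,\dots,c_k)$ of cells of $G$ which pairwise intersect; $\omega_k$ is extended additively (with signs) to the strong ring. For $k=1$ this is the Euler characteristic. -}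

module Defs where

open import Data.Nat using (ℕ; zero; suc; _∸_)
open import Data.Integer using (ℤ; -1ℤ; 1ℤ; 0ℤ; _^_) renaming (_+_ to _+ℤ_; _*_ to _*ℤ_)
open import Data.Fin using (Fin)
import Data.Fin
open import Data.Fin.Subset using (Subset; _∩_; ∣_∣; Nonempty; _⊆_; inside)
open import Data.Fin.Subset.Properties using (nonempty?)
open import Data.List using (List; []; _∷_; map; filter; concatMap; foldr; _++_; [_])
open import Data.List.NonEmpty using (List⁺; toList; _⁺++⁺_) renaming ([_] to [_]⁺)
open import Data.List.Membership.Propositional using (_∈_)
open import Data.List.Relation.Unary.All using (All)
open import Data.List.Relation.Unary.AllPairs using (AllPairs; allPairs?)
open import Data.List.Relation.Unary.Unique.Propositional using (Unique)
open import Data.Product using (_×_; _,_; Σ)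
open import Data.Unit using (⊤; tt)
open import Data.Vec using (_∷_; [])
import Data.Vec
import Data.List.Relation.Unary.All as All
import Data.List.Relation.Unary.Unique.Propositional as Unique
import Data.Nat
import Data.List.Relation.Unary.AllPairs.Core
open import Relation.Nullary using (Dec; yes; no)
open import Relation.Nullary.Decidable using (_×-dec_)

-- Finite abstract simplicial complexes, with vertex set Fin n.
-- A simplex is a subset of Fin n; the complex is a duplicate-free list of
-- nonempty simplices closed under taking nonempty subsets.

record Complex : Set where
  field
    n         : ℕ
    simplices : List (Subset n)
    unique    : Unique simplices
    nonempty  : All Nonempty simplices
    closed    : ∀ {x y : Subset n} → x ∈ simplices → y ⊆ x → Nonempty y → y ∈ simplices
open Complex public

dimSimplex : ∀ {n} → Subset n → ℕ
dimSimplex x = ∣ x ∣ ∸ 1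

-- Cartesian products of complexes A₁ × ⋯ × Aₘ  (m ≥ 1).

Product : Set
Product = List⁺ Complex

Cell : List Complex → Set
Cell []       = ⊤
Cell (A ∷ As) = Subset (n A) × Cell As

cells : (As : List Complex) → List (Cell As)
cells []       = [ tt ]
cells (A ∷ As) = concatMap (λ x → map (λ c → x , c) (cells As)) (simplices A)

dimCell : (As : List Complex) → Cell As → ℕ
dimCell []       tt      = 0
dimCell (A ∷ As) (x , c) = dimSimplex x Data.Nat.+ dimCell As c

ωcell : (As : List Complex) → Cell As → ℤ
ωcell As c = -1ℤ ^ dimCell As c

Intersect : (As : List Complex) → Cell As → Cell As → Set
Intersect []       tt      tt      = ⊤
Intersect (A ∷ As) (x , c) (y , d) = Nonempty (x ∩ y) × Intersect As c d

intersect? : (As : List Complex) → (c d : Cell As) → Dec (Intersect As c d)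
intersect? []       tt      tt      = yes tt
intersect? (A ∷ As) (x , c) (y , d) = nonempty? (x ∩ y) ×-dec intersect? As c d

tuples : ∀ {X : Set} → ℕ → List X → List (List X)
tuples zero    xs = [ [] ]
tuples (suc k) xs = concatMap (λ x → map (x ∷_) (tuples k xs)) xs

sumℤ : List ℤ → ℤ
sumℤ = foldr _+ℤ_ 0ℤ

productℤ : List ℤ → ℤ
productℤ = foldr _*ℤ_ 1ℤ

ωProd : ℕ → Product → ℤ
ωProd k P = sumℤ (map (λ t → productℤ (map (ωcell As) t))
                      (filter (allPairs? (intersect? As)) (tuples k (cells As))))
  where As = toList P

-- The strong ring: formal integer combinations of products of complexes.

Strong : Set
Strong = List (ℤ × Product)

-- addition = (signed) disjoint union
_⊕_ : Strong → Strong → Strong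
G ⊕ H = G ++ H

-- multiplication = Cartesian product, extended bilinearly
_⊗_ : Strong → Strong → Strong
G ⊗ H = concatMap (λ { (a , P) → map (λ { (b , Q) → (a *ℤ b , P ⁺++⁺ Q) }) H }) G

K₁ : Complex
K₁ = record
  { n = 1
  ; simplices = (inside ∷ []) ∷ []
  ; unique = Data.List.Relation.Unary.AllPairs.Core.AllPairs._∷_ All.[] Data.List.Relation.Unary.AllPairs.Core.AllPairs.[]
  ; nonempty = (Data.Fin.zero , Data.Vec.here) All.∷ All.[]
  ; closed = cl
  }
  where
  open import Data.List.Relation.Unary.Any using (here)
  import Data.Fin.Subset
  open import Relation.Binary.PropositionalEquality using (refl)
  cl : ∀ {x y : Subset 1} → x ∈ ((inside ∷ []) ∷ []) → y ⊆ x → Nonempty y → y ∈ ((inside ∷ []) ∷ [])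
  cl {y = inside ∷ []} _ _ _ = here refl
  cl {y = Data.Fin.Subset.outside ∷ []} _ _ (Data.Fin.zero , ())

𝟙 : Strong
𝟙 = (1ℤ , [ K₁ ]⁺) ∷ []

𝟘 : Strong
𝟘 = []

ω : ℕ → Strong → ℤ
ω k G = sumℤ (map (λ { (a , P) → a *ℤ ωProd k P }) G)

{-# OPTIONS --safe #-}
module Submission where

-- The cells of a product A₁ × ⋯ × Aₘ × B₁ × ⋯ × Bₙ are the pairs of cells of the two factors,
-- so a k-tuple of them is a pair of k-tuples. Two joined cells intersect iff both halves do,
-- and ω is multiplicative on cells; hence the weight of a joined k-tuple is the product of the
-- weights of its halves, and by Fubini ω_k(P × Q) = ω_k(P) ω_k(Q). Bilinearity then extends
-- this to the strong ring, additivity holds because ω_k is defined additively, and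
-- ω_k(1) = 1 because the only k-tuple of cells of K₁ repeats its single vertex.

open import Defs
open import Data.Nat using (ℕ; _≥_; zero; suc; _+_)
import Data.Nat.Properties as ℕ
open import Data.Integer using (ℤ; 1ℤ; 0ℤ; -1ℤ; _^_) renaming (_+_ to _+ℤ_; _*_ to _*ℤ_)
open import Data.Integer.Properties
  using (+-identityˡ; +-identityʳ; *-identityˡ; *-zeroʳ; *-distribʳ-+; *-distribˡ-+; ^-distribˡ-+-*;
         +-assoc; +-commutativeSemigroup; *-commutativeSemigroup)
open import Algebra.Properties.CommutativeSemigroup +-commutativeSemigroup
  using () renaming (interchange to +-interchange)
open import Algebra.Properties.CommutativeSemigroup *-commutativeSemigroup
  using () renaming (interchange to *-interchange)
open import Data.Bool using (Bool; true; false; _∧_; if_then_else_)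
open import Data.Product using (_×_; _,_; proj₂)
open import Data.Unit using (tt)
open import Data.List using (List; []; _∷_; [_]; map; filter; concatMap; _++_; length; replicate; zipWith)
open import Data.List.Properties using (map-∘; map-cong; map-++; map-replicate; ++-identityʳ)
open import Data.List.NonEmpty using (toList; _⁺++⁺_) renaming ([_] to [_]⁺)
open import Data.List.Relation.Unary.All using (All; []; _∷_)
import Data.List.Relation.Unary.All.Properties as All
open import Data.List.Relation.Unary.AllPairs using (AllPairs; []; _∷_; allPairs?)
open import Data.Fin.Subset using (inside)
open import Data.Vec using (_∷_; []; here)
import Data.Fin as Fin
open import Function using (_∘_; _⇔_; mk⇔; Equivalence)
open import Relation.Nullary using (Dec; does)
open import Relation.Nullary.Decidable using (does-⇔; dec-true; _×-dec_)
open import Relation.Binary.PropositionalEquality using (_≡_; _≗_; refl; sym; trans; cong; cong₂)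
open Relation.Binary.PropositionalEquality.≡-Reasoning

private
  variable
    X Y Z : Set

Σ : List X → (X → ℤ) → ℤ
Σ xs f = sumℤ (map f xs)

sumℤ-++ : (xs ys : List ℤ) → sumℤ (xs ++ ys) ≡ sumℤ xs +ℤ sumℤ ys
sumℤ-++ []       ys = sym (+-identityˡ (sumℤ ys))
sumℤ-++ (x ∷ xs) ys = trans (cong (x +ℤ_) (sumℤ-++ xs ys)) (sym (+-assoc x (sumℤ xs) (sumℤ ys)))

Σ-cong : (xs : List X) {f g : X → ℤ} → f ≗ g → Σ xs f ≡ Σ xs g
Σ-cong xs f≗g = cong sumℤ (map-cong f≗g xs)

Σ-++ : (xs ys : List X) (f : X → ℤ) → Σ (xs ++ ys) f ≡ Σ xs f +ℤ Σ ys f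
Σ-++ xs ys f = trans (cong sumℤ (map-++ f xs ys)) (sumℤ-++ (map f xs) (map f ys))

Σ-map : (g : X → Y) (xs : List X) (f : Y → ℤ) → Σ (map g xs) f ≡ Σ xs (f ∘ g)
Σ-map g xs f = cong sumℤ (sym (map-∘ xs))

Σ-concatMap : (g : X → List Y) (xs : List X) (f : Y → ℤ) →
              Σ (concatMap g xs) f ≡ Σ xs (λ x → Σ (g x) f)
Σ-concatMap g []       f = refl
Σ-concatMap g (x ∷ xs) f =
  trans (Σ-++ (g x) (concatMap g xs) f) (cong (Σ (g x) f +ℤ_) (Σ-concatMap g xs f))

Σ-zero : (xs : List X) → Σ xs (λ _ → 0ℤ) ≡ 0ℤ
Σ-zero []       = refl
Σ-zero (x ∷ xs) = trans (+-identityˡ _) (Σ-zero xs)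

Σ-+ : (xs : List X) (f g : X → ℤ) → Σ xs (λ x → f x +ℤ g x) ≡ Σ xs f +ℤ Σ xs g
Σ-+ []       f g = refl
Σ-+ (x ∷ xs) f g =
  trans (cong (f x +ℤ g x +ℤ_) (Σ-+ xs f g)) (+-interchange (f x) (g x) (Σ xs f) (Σ xs g))

Σ-swap : (xs : List X) (ys : List Y) (f : X → Y → ℤ) →
         Σ xs (λ x → Σ ys (f x)) ≡ Σ ys (λ y → Σ xs (λ x → f x y))
Σ-swap []       ys f = sym (Σ-zero ys)
Σ-swap (x ∷ xs) ys f =
  trans (cong (Σ ys (f x) +ℤ_) (Σ-swap xs ys f)) (sym (Σ-+ ys (f x) (λ y → Σ xs (λ x → f x y))))

Σ-*ˡ : (c : ℤ) (xs : List X) (f : X → ℤ) → c *ℤ Σ xs f ≡ Σ xs (λ x → c *ℤ f x)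
Σ-*ˡ c []       f = *-zeroʳ c
Σ-*ˡ c (x ∷ xs) f = trans (*-distribˡ-+ c (f x) (Σ xs f)) (cong (c *ℤ f x +ℤ_) (Σ-*ˡ c xs f))

Σ-*ʳ : (c : ℤ) (xs : List X) (f : X → ℤ) → Σ xs f *ℤ c ≡ Σ xs (λ x → f x *ℤ c)
Σ-*ʳ c []       f = refl
Σ-*ʳ c (x ∷ xs) f = trans (*-distribʳ-+ c (f x) (Σ xs f)) (cong (f x *ℤ c +ℤ_) (Σ-*ʳ c xs f))

Σ-*-Σ : (xs : List X) (ys : List Y) (f : X → ℤ) (g : Y → ℤ) →
        Σ xs f *ℤ Σ ys g ≡ Σ xs (λ x → Σ ys (λ y → f x *ℤ g y))
Σ-*-Σ xs ys f g = trans (Σ-*ʳ (Σ ys g) xs f) (Σ-cong xs (λ x → Σ-*ˡ (f x) ys g))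

Σ-filter : {P : X → Set} (P? : ∀ x → Dec (P x)) (xs : List X) (f : X → ℤ) →
           Σ (filter P? xs) f ≡ Σ xs (λ x → if does (P? x) then f x else 0ℤ)
Σ-filter P? []       f = refl
Σ-filter P? (x ∷ xs) f with does (P? x)
... | true  = cong (f x +ℤ_) (Σ-filter P? xs f)
... | false = trans (Σ-filter P? xs f) (sym (+-identityˡ _))

if-∧-* : (b c : Bool) (x y : ℤ) →
         (if b ∧ c then x *ℤ y else 0ℤ) ≡ (if b then x else 0ℤ) *ℤ (if c then y else 0ℤ)
if-∧-* true  true  x y = refl
if-∧-* true  false x y = sym (*-zeroʳ x)
if-∧-* false c     x y = refl

productℤ-replicate-1ℤ : ∀ k → productℤ (replicate k 1ℤ) ≡ 1ℤ
productℤ-replicate-1ℤ zero    = refl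
productℤ-replicate-1ℤ (suc k) = trans (*-identityˡ _) (productℤ-replicate-1ℤ k)

productℤ-zipWith : {join : X → Y → Z} {f : X → ℤ} {g : Y → ℤ} {h : Z → ℤ} →
                   (∀ x y → h (join x y) ≡ f x *ℤ g y) →
                   ∀ u v → length u ≡ length v →
                   productℤ (map h (zipWith join u v)) ≡ productℤ (map f u) *ℤ productℤ (map g v)
productℤ-zipWith h-join []      []      _    = refl
productℤ-zipWith {f = f} {g} h-join (x ∷ u) (y ∷ v) |u|≡|v| =
  trans (cong₂ _*ℤ_ (h-join x y) (productℤ-zipWith {f = f} {g} h-join u v (ℕ.suc-injective |u|≡|v|)))
        (*-interchange (f x) (g y) (productℤ (map f u)) (productℤ (map g v)))

Σ-tuples-suc : (k : ℕ) (xs : List X) (f : List X → ℤ) →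
               Σ (tuples (suc k) xs) f ≡ Σ xs (λ x → Σ (tuples k xs) (f ∘ (x ∷_)))
Σ-tuples-suc k xs f = trans (Σ-concatMap (λ x → map (x ∷_) (tuples k xs)) xs f)
                            (Σ-cong xs (λ x → Σ-map (x ∷_) (tuples k xs) f))

Σ-cong-tuples : (k : ℕ) (xs : List X) {f g : List X → ℤ} →
                (∀ t → length t ≡ k → f t ≡ g t) → Σ (tuples k xs) f ≡ Σ (tuples k xs) g
Σ-cong-tuples zero    xs f≗g = cong (_+ℤ 0ℤ) (f≗g [] refl)
Σ-cong-tuples (suc k) xs {f} {g} f≗g = begin
  Σ (tuples (suc k) xs) f                        ≡⟨ Σ-tuples-suc k xs f ⟩
  Σ xs (λ x → Σ (tuples k xs) (f ∘ (x ∷_)))      ≡⟨ Σ-cong xs (λ x → Σ-cong-tuples k xs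
                                                       (λ t |t| → f≗g (x ∷ t) (cong suc |t|))) ⟩
  Σ xs (λ x → Σ (tuples k xs) (g ∘ (x ∷_)))      ≡⟨ Σ-tuples-suc k xs g ⟨
  Σ (tuples (suc k) xs) g                        ∎

tuples-[-] : ∀ k (x : X) → tuples k [ x ] ≡ [ replicate k x ]
tuples-[-] zero    x = refl
tuples-[-] (suc k) x = trans (++-identityʳ _) (cong (map (x ∷_)) (tuples-[-] k x))

-- zs enumerates the pairs of elements of xs and ys, read through join, as far as sums can tell.
ProductEnumeration : (X → Y → Z) → List X → List Y → List Z → Set
ProductEnumeration join xs ys zs = ∀ f → Σ zs f ≡ Σ xs (λ x → Σ ys (f ∘ join x))

tuples-product : {join : X → Y → Z} {xs : List X} {ys : List Y} {zs : List Z} →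
                 ProductEnumeration join xs ys zs →
                 ∀ k → ProductEnumeration (zipWith join) (tuples k xs) (tuples k ys) (tuples k zs)
tuples-product zs≅xs×ys zero f =
  cong (_+ℤ 0ℤ) (sym (+-identityʳ (f [])))
tuples-product {join = join} {xs} {ys} {zs} zs≅xs×ys (suc k) f = begin
  Σ (tuples (suc k) zs) f
    ≡⟨ Σ-tuples-suc k zs f ⟩
  Σ zs (λ z → Σ (tuples k zs) (f ∘ (z ∷_)))
    ≡⟨ zs≅xs×ys _ ⟩
  Σ xs (λ x → Σ ys (λ y → Σ (tuples k zs) (f ∘ (join x y ∷_))))
    ≡⟨ Σ-cong xs (λ x → Σ-cong ys (λ y → tuples-product zs≅xs×ys k (f ∘ (join x y ∷_)))) ⟩
  Σ xs (λ x → Σ ys (λ y → Σ (tuples k xs) (λ u → Σ (tuples k ys) (λ v → f (zipWith join (x ∷ u) (y ∷ v))))))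
    ≡⟨ Σ-cong xs (λ x → Σ-swap ys (tuples k xs) _) ⟩
  Σ xs (λ x → Σ (tuples k xs) (λ u → Σ ys (λ y → Σ (tuples k ys) (λ v → f (zipWith join (x ∷ u) (y ∷ v))))))
    ≡⟨ Σ-cong xs (λ x → Σ-cong (tuples k xs) (λ u → Σ-tuples-suc k ys _)) ⟨
  Σ xs (λ x → Σ (tuples k xs) (λ u → Σ (tuples (suc k) ys) (f ∘ zipWith join (x ∷ u))))
    ≡⟨ Σ-tuples-suc k xs _ ⟨
  Σ (tuples (suc k) xs) (λ u → Σ (tuples (suc k) ys) (f ∘ zipWith join u))
    ∎

module _ {RX : X → X → Set} {RY : Y → Y → Set} {RZ : Z → Z → Set} {join : X → Y → Z}
         (RZ⇔RX×RY : ∀ {x y x′ y′} → RZ (join x y) (join x′ y′) ⇔ (RX x x′ × RY y y′)) where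

  open Equivalence

  All-zipWith⇔ : ∀ {x y} u v → length u ≡ length v →
                 All (RZ (join x y)) (zipWith join u v) ⇔ (All (RX x) u × All (RY y) v)
  All-zipWith⇔ []       []       _ = mk⇔ (λ _ → [] , []) (λ _ → [])
  All-zipWith⇔ {x} {y} (x′ ∷ u) (y′ ∷ v) |u|≡|v| = mk⇔
    (λ { (r ∷ rs) → let (p , q) = to RZ⇔RX×RY r ; (ps , qs) = to rest rs in (p ∷ ps) , (q ∷ qs) })
    (λ { ((p ∷ ps) , (q ∷ qs)) → from RZ⇔RX×RY (p , q) ∷ from rest (ps , qs) })
    where
    rest : All (RZ (join x y)) (zipWith join u v) ⇔ (All (RX x) u × All (RY y) v)
    rest = All-zipWith⇔ u v (ℕ.suc-injective |u|≡|v|)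

  AllPairs-zipWith⇔ : ∀ u v → length u ≡ length v →
                      AllPairs RZ (zipWith join u v) ⇔ (AllPairs RX u × AllPairs RY v)
  AllPairs-zipWith⇔ []      []      _ = mk⇔ (λ _ → [] , []) (λ _ → [])
  AllPairs-zipWith⇔ (x ∷ u) (y ∷ v) |u|≡|v| = mk⇔
    (λ { (r ∷ rs) → let (p , q) = to heads r ; (ps , qs) = to rest rs in (p ∷ ps) , (q ∷ qs) })
    (λ { ((p ∷ ps) , (q ∷ qs)) → from heads (p , q) ∷ from rest (ps , qs) })
    where
    heads : All (RZ (join x y)) (zipWith join u v) ⇔ (All (RX x) u × All (RY y) v)
    heads = All-zipWith⇔ u v (ℕ.suc-injective |u|≡|v|)
    rest : AllPairs RZ (zipWith join u v) ⇔ (AllPairs RX u × AllPairs RY v)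
    rest = AllPairs-zipWith⇔ u v (ℕ.suc-injective |u|≡|v|)

AllPairs-replicate : {R : X → X → Set} {x : X} → R x x → ∀ k → AllPairs R (replicate k x)
AllPairs-replicate Rxx zero    = []
AllPairs-replicate Rxx (suc k) = All.replicate⁺ k Rxx ∷ AllPairs-replicate Rxx k

joinCell : (As Bs : List Complex) → Cell As → Cell Bs → Cell (As ++ Bs)
joinCell []       Bs tt      d = d
joinCell (A ∷ As) Bs (x , c) d = x , joinCell As Bs c d

cells-++ : (As Bs : List Complex) → ProductEnumeration (joinCell As Bs) (cells As) (cells Bs) (cells (As ++ Bs))
cells-++ []       Bs f = sym (+-identityʳ _)
cells-++ (A ∷ As) Bs f = begin
  Σ (cells (A ∷ As ++ Bs)) f
    ≡⟨ Σ-concatMap _ (simplices A) f ⟩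
  Σ (simplices A) (λ x → Σ (map (x ,_) (cells (As ++ Bs))) f)
    ≡⟨ Σ-cong (simplices A) (λ x → trans (Σ-map (x ,_) (cells (As ++ Bs)) f) (cells-++ As Bs (f ∘ (x ,_)))) ⟩
  Σ (simplices A) (λ x → Σ (cells As) (λ c → Σ (cells Bs) (f ∘ joinCell (A ∷ As) Bs (x , c))))
    ≡⟨ Σ-cong (simplices A) (λ x → Σ-map (x ,_) (cells As) _) ⟨
  Σ (simplices A) (λ x → Σ (map (x ,_) (cells As)) (λ c → Σ (cells Bs) (f ∘ joinCell (A ∷ As) Bs c)))
    ≡⟨ Σ-concatMap _ (simplices A) _ ⟨
  Σ (cells (A ∷ As)) (λ c → Σ (cells Bs) (f ∘ joinCell (A ∷ As) Bs c))
    ∎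

dimCell-joinCell : (As Bs : List Complex) (c : Cell As) (d : Cell Bs) →
                   dimCell (As ++ Bs) (joinCell As Bs c d) ≡ dimCell As c + dimCell Bs d
dimCell-joinCell []       Bs tt      d = refl
dimCell-joinCell (A ∷ As) Bs (x , c) d =
  trans (cong (dimSimplex x +_) (dimCell-joinCell As Bs c d)) (sym (ℕ.+-assoc (dimSimplex x) _ _))

ωcell-joinCell : (As Bs : List Complex) (c : Cell As) (d : Cell Bs) →
                 ωcell (As ++ Bs) (joinCell As Bs c d) ≡ ωcell As c *ℤ ωcell Bs d
ωcell-joinCell As Bs c d =
  trans (cong (-1ℤ ^_) (dimCell-joinCell As Bs c d)) (^-distribˡ-+-* -1ℤ (dimCell As c) (dimCell Bs d))

Intersect-joinCell⇔ : (As Bs : List Complex) {c c′ : Cell As} {d d′ : Cell Bs} →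
                      Intersect (As ++ Bs) (joinCell As Bs c d) (joinCell As Bs c′ d′) ⇔
                      (Intersect As c c′ × Intersect Bs d d′)
Intersect-joinCell⇔ []       Bs {tt} {tt} = mk⇔ (tt ,_) proj₂
Intersect-joinCell⇔ (A ∷ As) Bs {x , c} {x′ , c′} {d} {d′} = mk⇔
  (λ (p , q) → let (a , b) = Equivalence.to rest q in (p , a) , b)
  (λ ((p , a) , b) → p , Equivalence.from rest (a , b))
  where
  rest : Intersect (As ++ Bs) (joinCell As Bs c d) (joinCell As Bs c′ d′) ⇔ (Intersect As c c′ × Intersect Bs d d′)
  rest = Intersect-joinCell⇔ As Bs

weight : (As : List Complex) → List (Cell As) → ℤ
weight As t = if does (allPairs? (intersect? As) t) then productℤ (map (ωcell As) t) else 0ℤ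

ωProd-weight : ∀ k P → ωProd k P ≡ Σ (tuples k (cells (toList P))) (weight (toList P))
ωProd-weight k P = Σ-filter (allPairs? (intersect? As)) (tuples k (cells As)) (productℤ ∘ map (ωcell As))
  where
  As : List Complex
  As = toList P

weight-zipWith : (As Bs : List Complex) (u : List (Cell As)) (v : List (Cell Bs)) → length u ≡ length v →
                 weight (As ++ Bs) (zipWith (joinCell As Bs) u v) ≡ weight As u *ℤ weight Bs v
weight-zipWith As Bs u v |u|≡|v| = begin
  weight (As ++ Bs) (zipWith (joinCell As Bs) u v)
    ≡⟨ cong₂ (λ b x → if b then x else 0ℤ)
             (does-⇔ (AllPairs-zipWith⇔ (Intersect-joinCell⇔ As Bs) u v |u|≡|v|) uv? (u? ×-dec v?))
             (productℤ-zipWith {f = ωcell As} {ωcell Bs} (ωcell-joinCell As Bs) u v |u|≡|v|) ⟩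
  (if does u? ∧ does v? then productℤ (map (ωcell As) u) *ℤ productℤ (map (ωcell Bs) v) else 0ℤ)
    ≡⟨ if-∧-* (does u?) (does v?) _ _ ⟩
  weight As u *ℤ weight Bs v
    ∎
  where
  uv? : Dec (AllPairs (Intersect (As ++ Bs)) (zipWith (joinCell As Bs) u v))
  uv? = allPairs? (intersect? (As ++ Bs)) (zipWith (joinCell As Bs) u v)
  u? : Dec (AllPairs (Intersect As) u)
  u? = allPairs? (intersect? As) u
  v? : Dec (AllPairs (Intersect Bs) v)
  v? = allPairs? (intersect? Bs) v

ωProd-⁺++⁺ : ∀ k P Q → ωProd k (P ⁺++⁺ Q) ≡ ωProd k P *ℤ ωProd k Q
ωProd-⁺++⁺ k P Q = begin
  ωProd k (P ⁺++⁺ Q)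
    ≡⟨ ωProd-weight k (P ⁺++⁺ Q) ⟩
  Σ (tuples k (cells (As ++ Bs))) (weight (As ++ Bs))
    ≡⟨ tuples-product (cells-++ As Bs) k _ ⟩
  Σ (tuples k (cells As)) (λ u → Σ (tuples k (cells Bs)) (weight (As ++ Bs) ∘ zipWith (joinCell As Bs) u))
    ≡⟨ Σ-cong-tuples k (cells As) (λ u |u| → Σ-cong-tuples k (cells Bs) (λ v |v| →
         weight-zipWith As Bs u v (trans |u| (sym |v|)))) ⟩
  Σ (tuples k (cells As)) (λ u → Σ (tuples k (cells Bs)) (λ v → weight As u *ℤ weight Bs v))
    ≡⟨ Σ-*-Σ (tuples k (cells As)) (tuples k (cells Bs)) (weight As) (weight Bs) ⟨
  Σ (tuples k (cells As)) (weight As) *ℤ Σ (tuples k (cells Bs)) (weight Bs)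
    ≡⟨ cong₂ _*ℤ_ (ωProd-weight k P) (ωProd-weight k Q) ⟨
  ωProd k P *ℤ ωProd k Q
    ∎
  where
  As Bs : List Complex
  As = toList P
  Bs = toList Q

ωProd-K₁ : ∀ k → ωProd k [ K₁ ]⁺ ≡ 1ℤ
ωProd-K₁ k = begin
  ωProd k [ K₁ ]⁺                   ≡⟨ ωProd-weight k [ K₁ ]⁺ ⟩
  Σ (tuples k [ vertex ]) (weight A) ≡⟨ cong (λ ts → Σ ts (weight A)) (tuples-[-] k vertex) ⟩
  weight A vertexᵏ +ℤ 0ℤ            ≡⟨ +-identityʳ _ ⟩
  weight A vertexᵏ                  ≡⟨ cong (λ b → if b then productℤ (map (ωcell A) vertexᵏ) else 0ℤ)
                                            (dec-true (allPairs? (intersect? A) vertexᵏ)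
                                                      (AllPairs-replicate vertex∩vertex k)) ⟩
  productℤ (map (ωcell A) vertexᵏ)  ≡⟨ cong productℤ (map-replicate (ωcell A) k vertex) ⟩
  productℤ (replicate k 1ℤ)         ≡⟨ productℤ-replicate-1ℤ k ⟩
  1ℤ                                ∎
  where
  A : List Complex
  A = [ K₁ ]
  vertex : Cell A
  vertex = inside ∷ [] , tt
  vertexᵏ : List (Cell A)
  vertexᵏ = replicate k vertex
  vertex∩vertex : Intersect A vertex vertex
  vertex∩vertex = (Fin.zero , here) , tt

ω-⊕ : ∀ k G H → ω k (G ⊕ H) ≡ ω k G +ℤ ω k H
ω-⊕ k G H = Σ-++ G H _

ω-⊗ : ∀ k G H → ω k (G ⊗ H) ≡ ω k G *ℤ ω k H
ω-⊗ k G H = begin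
  ω k (G ⊗ H)
    ≡⟨ Σ-concatMap _ G _ ⟩
  Σ G (λ (a , P) → Σ (map (λ (b , Q) → a *ℤ b , P ⁺++⁺ Q) H) (λ (c , R) → c *ℤ ωProd k R))
    ≡⟨ Σ-cong G (λ (a , P) → trans (Σ-map _ H _) (Σ-cong H (λ (b , Q) →
         trans (cong (a *ℤ b *ℤ_) (ωProd-⁺++⁺ k P Q)) (*-interchange a b _ _)))) ⟩
  Σ G (λ (a , P) → Σ H (λ (b , Q) → (a *ℤ ωProd k P) *ℤ (b *ℤ ωProd k Q)))
    ≡⟨ Σ-*-Σ G H _ _ ⟨
  ω k G *ℤ ω k H
    ∎

mainTheorem6 : ∀ (k : ℕ) → k ≥ 1 →
    (∀ (G H : Strong) → ω k (G ⊕ H) ≡ ω k G +ℤ ω k H)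
    × (∀ (G H : Strong) → ω k (G ⊗ H) ≡ ω k G *ℤ ω k H)
    × (ω k 𝟙 ≡ 1ℤ)
mainTheorem6 k _ = ω-⊕ k , ω-⊗ k , trans (+-identityʳ _) (trans (*-identityˡ _) (ωProd-K₁ k))
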